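{- Let $a=(a_1,a_2,a_3,\dots)$ be an infinite $(0,1)$-vector, and let $\sigma,\tau$ be finite permutations. If $\sigma\in_a\tau$, then $\sigma\leq_a\tau$.
   Context: Permutations are written in one-line notation. For a permutation $\sigma$ of length $k$ and a permutation $\tau=\tau_1\cdots\tau_n$, we write $\sigma\in_a\tau$ if there are positions $1\le i_1<i_2<\cdots<i_k\le n$ such that $\tau_{i_1}\tau_{i_2}\cdots\tau_{i_k}$ is order-isomorphic to $\sigma$ (i.e. $\tau_{i_s}<\tau_{i_t}$ iff $\sigma_s<\sigma_t$) and, for every $j\in\{1,\dots,k-1\}$ with $a_j=0$, we have $i_{j+1}=i_j+1$ (positions $j$ with $a_j=1$ impose no adjacency condition). This is an occurrence of $\sigma$ as an $a$-vincular pattern. Define a covering relation: for permutations $\rho$ of length $n-1$ and $\pi$ of length $n$, $\rho\prec_a\pi$ iff $\rho\in_a\pi$. The relation $\leq_a$ is the reflexive and transitive closure of $\prec_a$ (the $a$-vincular pattern containment order). -}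

module Defs where

open import Data.Nat using (ℕ; suc)
open import Data.Bool using (Bool; false)
open import Data.Fin using (Fin; toℕ; _<_)
open import Data.Fin.Permutation using (Permutation′; _⟨$⟩ʳ_)
open import Data.Product using (Σ-syntax; _×_)
open import Function.Bundles using (_⇔_)
open import Relation.Binary.PropositionalEquality using (_≡_)

-- A (0,1)-vector a = (a_1, a_2, ...) is a function  a : ℕ → Bool,
-- with  a j  standing for  a_{j+1}  (false = 0, true = 1).
ZeroOneVec : Set
ZeroOneVec = ℕ → Bool

-- A permutation of length n, in one-line notation: position i ↦ σ ⟨$⟩ʳ i.
Perm : ℕ → Set
Perm = Permutation′

-- Positions are 0-based: the gap between positions s and s+1 of σ
-- (0-based) is the gap j = s+1 (1-based), governed by a_{j} = a (toℕ s).
record Occurs (a : ZeroOneVec) {k n : ℕ} (σ : Perm k) (τ : Perm n) : Set where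
  field
    pos        : Fin k → Fin n
    increasing : ∀ s t → s < t → pos s < pos t
    orderIso   : ∀ s t → ((τ ⟨$⟩ʳ pos s) < (τ ⟨$⟩ʳ pos t)) ⇔ ((σ ⟨$⟩ʳ s) < (σ ⟨$⟩ʳ t))
    adjacent   : ∀ (s t : Fin k) → toℕ t ≡ suc (toℕ s) → a (toℕ s) ≡ false →
                 toℕ (pos t) ≡ suc (toℕ (pos s))

syntax Occurs a σ τ = σ ∈[ a ] τ

_≺[_]_ : {m : ℕ} → Perm m → ZeroOneVec → Perm (suc m) → Set
ρ ≺[ a ] π = Occurs a ρ π

data _≤[_]_ : {m n : ℕ} → Perm m → ZeroOneVec → Perm n → Set where
  ≤-refl : ∀ {m} {σ τ : Perm m} {a} → (∀ i → σ ⟨$⟩ʳ i ≡ τ ⟨$⟩ʳ i) → σ ≤[ a ] τ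
  ≤-step : ∀ {l m} {a} {σ : Perm l} {ρ : Perm m} {π : Perm (suc m)} →
           σ ≤[ a ] ρ → ρ ≺[ a ] π → σ ≤[ a ] π

module Submission where

open import Data.Nat using (ℕ)
open import Defs

open import Data.Nat as ℕ using (zero; suc; z≤n; s≤s)
import Data.Nat.Properties as ℕₚ
open import Data.Bool using (true; false)
open import Data.Bool.Properties using (¬-not)
open import Data.Fin using (Fin; zero; suc; toℕ; punchIn; punchOut; fromℕ; fromℕ<; inject; inject₁; _<_; _≤_)
import Data.Fin.Properties as Finₚ
open import Data.Fin.Induction using (<-weakInduction)
open import Data.Fin.Permutation using (_⟨$⟩ʳ_; _⟨$⟩ˡ_; inverseˡ; inverseʳ; remove; punchIn-permute)
open import Data.Product using (Σ-syntax; _×_; _,_)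
open import Data.Sum using (_⊎_; inj₁; inj₂)
open import Function.Bundles using (_⇔_; mk⇔; Equivalence)
open import Function.Construct.Composition using (_⇔-∘_)
open import Function.Construct.Symmetry using (⇔-sym)
open import Relation.Binary using (tri<; tri≈; tri>)
open import Relation.Nullary using (¬_; Dec; yes; no; contradiction)
open import Relation.Unary using (Pred; Decidable)
open import Relation.Binary.PropositionalEquality
  using (_≡_; _≢_; refl; sym; trans; cong; subst; subst₂; module ≡-Reasoning)

-- Deleting the entry at position
-- d of τ gives the permutation  remove d τ, which sits inside τ via the position map
-- punchIn d; this is an a-vincular occurrence (so  remove d τ ≺_a τ) unless d splits
-- a gap that a requires to be adjacent.  Given an occurrence with position map pos:
--   * if pos is the identity and |σ| = |τ|, then σ and τ have the same order
--     pattern, hence are equal;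
--   * if pos is the identity and |σ| < |τ|, delete the last entry of τ;
--   * otherwise let s be the first index with pos s ≠ s and delete position s of τ:
--     it is unused, and were a_{s-1} = 0 the occurrence would force pos s = s.
-- In the last two cases the occurrence restricts to  remove d τ, and induction applies.

punchIn-below : ∀ {m} (d : Fin (suc m)) (j : Fin m) → j < d → toℕ (punchIn d j) ≡ toℕ j
punchIn-below (suc d) zero    _         = refl
punchIn-below (suc d) (suc j) (s≤s j<d) = cong suc (punchIn-below d j j<d)

punchIn-above : ∀ {m} (d : Fin (suc m)) (j : Fin m) → d ≤ j → toℕ (punchIn d j) ≡ suc (toℕ j)
punchIn-above zero    j       _         = refl
punchIn-above (suc d) (suc j) (s≤s d≤j) = cong suc (punchIn-above d j d≤j)

punchIn-inflationary : ∀ {m} (d : Fin (suc m)) (j : Fin m) → j ≤ punchIn d j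
punchIn-inflationary zero    j       = ℕₚ.n≤1+n (toℕ j)
punchIn-inflationary (suc d) zero    = z≤n
punchIn-inflationary (suc d) (suc j) = s≤s (punchIn-inflationary d j)

punchIn-<-⇔ : ∀ {m} (d : Fin (suc m)) (x y : Fin m) → (punchIn d x < punchIn d y) ⇔ (x < y)
punchIn-<-⇔ d x y = mk⇔ reflects preserves
  where
  preserves : x < y → punchIn d x < punchIn d y
  preserves x<y = Finₚ.≤∧≢⇒< (Finₚ.punchIn-mono-≤ d x y (ℕₚ.<⇒≤ x<y))
                             (λ eq → Finₚ.<⇒≢ x<y (Finₚ.punchIn-injective d x y eq))
  reflects : punchIn d x < punchIn d y → x < y
  reflects px<py = ℕₚ.≰⇒> (λ y≤x → ℕₚ.<⇒≱ px<py (Finₚ.punchIn-mono-≤ d y x y≤x))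

punchIn-preserves-successor : ∀ {m} (d : Fin (suc m)) (s t : Fin m) →
  toℕ t ≡ suc (toℕ s) → toℕ d ≢ toℕ t → toℕ (punchIn d t) ≡ suc (toℕ (punchIn d s))
punchIn-preserves-successor d s t t≡1+s d≢t with ℕₚ.<-cmp (toℕ t) (toℕ d)
... | tri< t<d _ _ = begin
  toℕ (punchIn d t)        ≡⟨ punchIn-below d t t<d ⟩
  toℕ t                    ≡⟨ t≡1+s ⟩
  suc (toℕ s)              ≡⟨ cong suc (punchIn-below d s s<d) ⟨
  suc (toℕ (punchIn d s))  ∎
  where
  open ≡-Reasoning
  s<d : s < d
  s<d = ℕₚ.<-trans (ℕₚ.≤-reflexive (sym t≡1+s)) t<d
... | tri≈ _ t≡d _ = contradiction (sym t≡d) d≢t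
... | tri> _ _ d<t = begin
  toℕ (punchIn d t)        ≡⟨ punchIn-above d t (ℕₚ.<⇒≤ d<t) ⟩
  suc (toℕ t)              ≡⟨ cong suc t≡1+s ⟩
  suc (suc (toℕ s))        ≡⟨ cong suc (punchIn-above d s d≤s) ⟨
  suc (toℕ (punchIn d s))  ∎
  where
  open ≡-Reasoning
  d≤s : d ≤ s
  d≤s = ℕ.s≤s⁻¹ (ℕₚ.<-≤-trans d<t (ℕₚ.≤-reflexive t≡1+s))

punchIn-reflects-successor : ∀ {m} (d : Fin (suc m)) (x y : Fin m) →
  toℕ (punchIn d y) ≡ suc (toℕ (punchIn d x)) → toℕ y ≡ suc (toℕ x)
punchIn-reflects-successor d x y eq = by-position (toℕ x ℕₚ.<? toℕ d)
  where
  x<y : x < y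
  x<y = Equivalence.to (punchIn-<-⇔ d x y) (ℕₚ.≤-reflexive (sym eq))
  -- Below d, x is fixed and y ≤ punchIn d y = x + 1; from d on, both are shifted.
  by-position : Dec (x < d) → toℕ y ≡ suc (toℕ x)
  by-position (yes x<d) = ℕₚ.≤-antisym y≤1+x x<y
    where
    y≤1+x : toℕ y ℕ.≤ suc (toℕ x)
    y≤1+x = ℕₚ.≤-trans (punchIn-inflationary d y)
                       (ℕₚ.≤-reflexive (trans eq (cong suc (punchIn-below d x x<d))))
  by-position (no x≮d) = ℕₚ.suc-injective (begin
    suc (toℕ y)              ≡⟨ punchIn-above d y (ℕₚ.≤-trans d≤x (ℕₚ.<⇒≤ x<y)) ⟨
    toℕ (punchIn d y)        ≡⟨ eq ⟩
    suc (toℕ (punchIn d x))  ≡⟨ cong suc (punchIn-above d x d≤x) ⟩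
    suc (suc (toℕ x))        ∎)
    where
    open ≡-Reasoning
    d≤x : d ≤ x
    d≤x = ℕₚ.≮⇒≥ x≮d

SafeDeletion : ZeroOneVec → {m : ℕ} → Fin (suc m) → Set
SafeDeletion a {m} d = ∀ x → toℕ d ≡ suc x → toℕ d ℕ.< m → a x ≡ true

remove-<-⇔ : ∀ {m} (τ : Perm (suc m)) (d : Fin (suc m)) (i j : Fin m) →
  (τ ⟨$⟩ʳ punchIn d i < τ ⟨$⟩ʳ punchIn d j) ⇔ (remove d τ ⟨$⟩ʳ i < remove d τ ⟨$⟩ʳ j)
remove-<-⇔ τ d i j =
  subst₂ (λ u v → (u < v) ⇔ (remove d τ ⟨$⟩ʳ i < remove d τ ⟨$⟩ʳ j))
         (sym (punchIn-permute τ d i)) (sym (punchIn-permute τ d j))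
         (punchIn-<-⇔ (τ ⟨$⟩ʳ d) _ _)

removal-covered : ∀ (a : ZeroOneVec) {m} (τ : Perm (suc m)) (d : Fin (suc m)) →
  SafeDeletion a d → remove d τ ≺[ a ] τ
removal-covered a {m} τ d safe = record
  { pos        = punchIn d
  ; increasing = λ s t → Equivalence.from (punchIn-<-⇔ d s t)
  ; orderIso   = remove-<-⇔ τ d
  ; adjacent   = adjacent
  }
  where
  adjacent : ∀ (s t : Fin m) → toℕ t ≡ suc (toℕ s) → a (toℕ s) ≡ false →
             toℕ (punchIn d t) ≡ suc (toℕ (punchIn d s))
  adjacent s t t≡1+s a≡0 = punchIn-preserves-successor d s t t≡1+s d≢t
    where
    -- d = t would make the gap (s, t) one with a_s = 1.
    d≢t : toℕ d ≢ toℕ t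
    d≢t d≡t = contradiction (trans (sym (safe (toℕ s) (trans d≡t t≡1+s) d<m)) a≡0) λ ()
      where
      d<m : toℕ d ℕ.< m
      d<m = subst (ℕ._< m) (sym d≡t) (Finₚ.toℕ<n t)

restrict : ∀ {a k m} {σ : Perm k} {τ : Perm (suc m)} (o : σ ∈[ a ] τ) (d : Fin (suc m)) →
  (∀ s → Occurs.pos o s ≢ d) → σ ∈[ a ] remove d τ
restrict {k = k} {m} {τ = τ} o d unused = record
  { pos        = pos′
  ; increasing = λ s t s<t → Equivalence.to (punchIn-<-⇔ d _ _)
                   (subst₂ _<_ (sym (punched s)) (sym (punched t)) (increasing s t s<t))
  ; orderIso   = λ s t → orderIso s t ⇔-∘ lift s t
  ; adjacent   = λ s t t≡1+s a≡0 → punchIn-reflects-successor d (pos′ s) (pos′ t)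
                   (subst₂ (λ u v → toℕ v ≡ suc (toℕ u)) (sym (punched s)) (sym (punched t))
                           (adjacent s t t≡1+s a≡0))
  }
  where
  open Occurs o
  pos′ : Fin k → Fin m
  pos′ s = punchOut (λ d≡pos → unused s (sym d≡pos))
  punched : ∀ s → punchIn d (pos′ s) ≡ pos s
  punched s = Finₚ.punchIn-punchOut _
  lift : ∀ s t → (remove d τ ⟨$⟩ʳ pos′ s < remove d τ ⟨$⟩ʳ pos′ t) ⇔ (τ ⟨$⟩ʳ pos s < τ ⟨$⟩ʳ pos t)
  lift s t = subst₂ (λ u v → (remove d τ ⟨$⟩ʳ pos′ s < remove d τ ⟨$⟩ʳ pos′ t) ⇔ (τ ⟨$⟩ʳ u < τ ⟨$⟩ʳ v))
                    (punched s) (punched t)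
                    (⇔-sym (remove-<-⇔ τ d (pos′ s) (pos′ t)))

increasing⇒inflationary : ∀ {k n} (f : Fin k → Fin n) →
  (∀ i j → i < j → f i < f j) → ∀ i → i ≤ f i
increasing⇒inflationary {suc k} f f-inc = <-weakInduction (λ i → i ≤ f i) z≤n step
  where
  step : ∀ i → inject₁ i ≤ f (inject₁ i) → suc i ≤ f (suc i)
  step i ih = ℕₚ.≤-<-trans (subst (ℕ._≤ toℕ (f (inject₁ i))) (Finₚ.toℕ-inject₁ i) ih)
                           (f-inc (inject₁ i) (suc i) (s≤s (ℕₚ.≤-reflexive (Finₚ.toℕ-inject₁ i))))

-- If every comparison τ i < τ j also holds in σ, then σ ∘ τ⁻¹ is strictly increasing,
-- so each entry of τ is at most the corresponding entry of σ.
order-refinement⇒≤ : ∀ {n} (σ τ : Perm n) →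
  (∀ i j → τ ⟨$⟩ʳ i < τ ⟨$⟩ʳ j → σ ⟨$⟩ʳ i < σ ⟨$⟩ʳ j) → ∀ i → τ ⟨$⟩ʳ i ≤ σ ⟨$⟩ʳ i
order-refinement⇒≤ {n} σ τ refines i =
  subst (λ j → τ ⟨$⟩ʳ i ≤ σ ⟨$⟩ʳ j) (inverseˡ τ) (increasing⇒inflationary f f-inc (τ ⟨$⟩ʳ i))
  where
  f : Fin n → Fin n
  f v = σ ⟨$⟩ʳ (τ ⟨$⟩ˡ v)
  f-inc : ∀ v w → v < w → f v < f w
  f-inc v w v<w = refines _ _ (subst₂ _<_ (sym (inverseʳ τ)) (sym (inverseʳ τ)) v<w)

same-pattern⇒equal : ∀ {n} (σ τ : Perm n) →
  (∀ i j → (τ ⟨$⟩ʳ i < τ ⟨$⟩ʳ j) ⇔ (σ ⟨$⟩ʳ i < σ ⟨$⟩ʳ j)) → ∀ i → σ ⟨$⟩ʳ i ≡ τ ⟨$⟩ʳ i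
same-pattern⇒equal σ τ same-order i = Finₚ.toℕ-injective (ℕₚ.≤-antisym
  (order-refinement⇒≤ τ σ (λ i j → Equivalence.from (same-order i j)) i)
  (order-refinement⇒≤ σ τ (λ i j → Equivalence.to (same-order i j)) i))

identity-occurrence⇒equal : ∀ {a n} {σ τ : Perm n} (o : σ ∈[ a ] τ) →
  (∀ i → toℕ (Occurs.pos o i) ≡ toℕ i) → ∀ i → σ ⟨$⟩ʳ i ≡ τ ⟨$⟩ʳ i
identity-occurrence⇒equal {σ = σ} {τ} o fixes = same-pattern⇒equal σ τ λ i j →
  subst₂ (λ u v → (τ ⟨$⟩ʳ u < τ ⟨$⟩ʳ v) ⇔ (σ ⟨$⟩ʳ i < σ ⟨$⟩ʳ j))
         (Finₚ.toℕ-injective (fixes i)) (Finₚ.toℕ-injective (fixes j)) (orderIso i j)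
  where open Occurs o

least-counterexample : ∀ {k p} (P : Pred (Fin k) p) → Decidable P →
  (∀ i → P i) ⊎ (Σ[ s ∈ Fin k ] ¬ P s × (∀ i → i < s → P i))
least-counterexample {k} P P? with Finₚ.all? P?
... | yes all = inj₁ all
... | no ¬all with Finₚ.¬∀⟶∃¬-smallest k P P? ¬all
...   | s , ¬Ps , below = inj₂ (s , ¬Ps , λ i i<s → subst P (inject-fromℕ< i i<s) (below (fromℕ< i<s)))
  where
  inject-fromℕ< : ∀ i (i<s : i < s) → inject (fromℕ< i<s) ≡ i
  inject-fromℕ< i i<s = Finₚ.toℕ-injective (trans (Finₚ.toℕ-inject _) (Finₚ.toℕ-fromℕ< i<s))

module _ {a : ZeroOneVec} {k m : ℕ} {σ : Perm k} {τ : Perm (suc m)} (o : σ ∈[ a ] τ) where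
  open Occurs o

  Deletable : Fin (suc m) → Set
  Deletable d = (∀ s → pos s ≢ d) × SafeDeletion a d

  last-deletable : (∀ i → toℕ (pos i) ≡ toℕ i) → k ℕ.≤ m → Deletable (fromℕ m)
  last-deletable fixes k≤m = unused , safe
    where
    unused : ∀ s → pos s ≢ fromℕ m
    unused s pos≡last = ℕₚ.<-irrefl s≡m (ℕₚ.<-≤-trans (Finₚ.toℕ<n s) k≤m)
      where
      s≡m : toℕ s ≡ m
      s≡m = trans (sym (fixes s)) (trans (cong toℕ pos≡last) (Finₚ.toℕ-fromℕ m))
    safe : SafeDeletion a (fromℕ m)
    safe _ _ last<m = contradiction (subst (ℕ._< m) (Finₚ.toℕ-fromℕ m) last<m) (ℕₚ.<-irrefl refl)

  -- If s is the first index moved by pos, position s of τ is deletable: pos skips it,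
  -- and a_{s-1} = 0 would pin pos s to pos (s-1) + 1 = s.
  first-moved-deletable : (s : Fin k) → toℕ (pos s) ≢ toℕ s →
    (∀ i → i < s → toℕ (pos i) ≡ toℕ i) → Σ[ d ∈ Fin (suc m) ] Deletable d
  first-moved-deletable s moved fixed = d , unused , safe
    where
    s<pos : s < pos s
    s<pos = ℕₚ.≤∧≢⇒< (increasing⇒inflationary pos increasing s) (λ s≡pos → moved (sym s≡pos))
    d : Fin (suc m)
    d = fromℕ< (ℕₚ.<-trans s<pos (Finₚ.toℕ<n (pos s)))
    d≡s : toℕ d ≡ toℕ s
    d≡s = Finₚ.toℕ-fromℕ< _
    unused : ∀ i → pos i ≢ d
    unused i pos≡d with ℕₚ.<-cmp (toℕ i) (toℕ s)
    ... | tri< i<s _ _ = ℕₚ.<-irrefl (trans (sym (fixed i i<s)) (trans (cong toℕ pos≡d) d≡s)) i<s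
    ... | tri≈ _ i≡s _ =
      moved (trans (cong toℕ (subst (λ j → pos j ≡ d) (Finₚ.toℕ-injective i≡s) pos≡d)) d≡s)
    ... | tri> _ _ s<i =
      ℕₚ.<-irrefl (sym (trans (cong toℕ pos≡d) d≡s)) (ℕₚ.<-trans s<pos (increasing s i s<i))
    pinned : ∀ x → toℕ s ≡ suc x → a x ≡ false → toℕ (pos s) ≡ toℕ s
    pinned x s≡1+x a≡0 = begin
      toℕ (pos s)        ≡⟨ adjacent p s (trans s≡1+x (cong suc (sym p≡x)))
                                         (subst (λ y → a y ≡ false) (sym p≡x) a≡0) ⟩
      suc (toℕ (pos p))  ≡⟨ cong suc (trans (fixed p p<s) p≡x) ⟩
      suc x              ≡⟨ s≡1+x ⟨
      toℕ s              ∎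
      where
      open ≡-Reasoning
      x<s : x ℕ.< toℕ s
      x<s = ℕₚ.≤-reflexive (sym s≡1+x)
      p : Fin k
      p = fromℕ< (ℕₚ.<-trans x<s (Finₚ.toℕ<n s))
      p≡x : toℕ p ≡ x
      p≡x = Finₚ.toℕ-fromℕ< _
      p<s : p < s
      p<s = subst (ℕ._< toℕ s) (sym p≡x) x<s
    safe : SafeDeletion a d
    safe x d≡1+x _ = ¬-not (λ a≡0 → moved (pinned x (trans (sym d≡s) d≡1+x) a≡0))

  identity-or-deletable :
    (k ≡ suc m × (∀ i → toℕ (pos i) ≡ toℕ i)) ⊎ (Σ[ d ∈ Fin (suc m) ] Deletable d)
  identity-or-deletable
    with least-counterexample (λ i → toℕ (pos i) ≡ toℕ i) (λ i → toℕ (pos i) ℕₚ.≟ toℕ i)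
  ... | inj₂ (s , moved , fixed) = inj₂ (first-moved-deletable s moved fixed)
  ... | inj₁ fixes with ℕₚ.<-cmp k (suc m)
  ...   | tri< k<n _ _ = inj₂ (fromℕ m , last-deletable fixes (ℕ.s≤s⁻¹ k<n))
  ...   | tri≈ _ k≡n _ = inj₁ (k≡n , fixes)
  ...   | tri> _ _ n<k = contradiction (Finₚ.toℕ<n (pos i))
                           (ℕₚ.<-irrefl (trans (fixes i) (Finₚ.toℕ-fromℕ< n<k)))
    where
    i : Fin k
    i = fromℕ< n<k

proposition2p1 : (a : ZeroOneVec) {k n : ℕ} (σ : Perm k) (τ : Perm n) →
    σ ∈[ a ] τ → σ ≤[ a ] τ
proposition2p1 a {zero}  {zero}  σ τ o = ≤-refl (λ ())
proposition2p1 a {suc k} {zero}  σ τ o with Occurs.pos o zero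
... | ()
proposition2p1 a {n = suc m} σ τ o with identity-or-deletable o
... | inj₁ (refl , fixes) = ≤-refl (identity-occurrence⇒equal o fixes)
... | inj₂ (d , unused , safe) =
  ≤-step (proposition2p1 a σ (remove d τ) (restrict o d unused)) (removal-covered a τ d safe)
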